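{- Let $b$ be a vertex of $H$, $i\in\Gamma(b)$ and $j\notin\Gamma(b)$. If $\vec T$ is distinctly colorable and satisfies Condition 2 or Condition 3 at $b$ but not Condition 1 at $b$, then neither $v_i$ nor $w_i$ equals $v_j$ or $w_j$.
   Context: $H$ is a connected finite simple graph with no leaves, vertices $1,\dots,t$, $k$ edges, oriented arbitrarily with directed edges $\overrightarrow{a_1a_2},\dots,\overrightarrow{a_{2k-1}a_{2k}}$; $\Gamma(b)=\{i\in\{1,\dots,2k\}:a_i=b\}$. $G$ is a finite simple graph and $\vec G$ its symmetric digraph. $\vec T=(\vec T_1,\vec T_2)$ is a $2k$-tuple of edges of $\vec G$ with $\vec T_1=(\overrightarrow{v_1v_2},\dots,\overrightarrow{v_{2k-1}v_{2k}})$, $\vec T_2=(\overrightarrow{w_1w_2},\dots,\overrightarrow{w_{2k-1}w_{2k}})$. $\vec T$ is distinctly colorable if for all distinct vertices $b\ne c$ of $H$ and all $i\in\Gamma(b)$, $j\in\Gamma(c)$: $v_i\neq v_j$ and $w_i\ne w_j$. Conditions at $b$: Condition 1: the $v_i$, $i\in\Gamma(b)$, are all equal and the $w_i$, $i\in\Gamma(b)$, are all equal. Condition 2: $v_i=w_i$ for all $i\in\Gamma(b)$. Condition 3: there are vertices $x,y$ of $G$ such that for every $i\in\Gamma(b)$, either ($v_i=x$, $w_i=y$) or ($v_i=y$, $w_i=x$). -}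

module Defs where

open import Data.Nat using (ℕ; _*_)
open import Data.Fin using (Fin; combine; zero; suc)
open import Data.Product using (_×_; ∃; ∃-syntax; Σ)
open import Data.Sum using (_⊎_)
open import Relation.Nullary using (¬_)
open import Relation.Binary.PropositionalEquality using (_≡_; _≢_)

-- Positions 1..2k of the paper are modelled by Fin (k * 2) (0-based):
-- position  l*2 + 0  is the tail  a_{2l+1}, position  l*2 + 1  the head  a_{2l+2}
-- of the l-th oriented edge of H.
tl : {k : ℕ} → Fin k → Fin (k * 2)
tl l = combine {n = 2} l zero

hd : {k : ℕ} → Fin k → Fin (k * 2)
hd l = combine {n = 2} l (suc zero)

-- H (vertices Fin t, k oriented edges) is given by the labelling
-- a : positions → vertices, with edge l = a(tl l) → a(hd l).
record OGraph (t k : ℕ) : Set where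
  constructor mkOGraph
  field
    a : Fin (k * 2) → Fin t
open OGraph public

Γ∋ : {t k : ℕ} → OGraph t k → Fin t → Fin (k * 2) → Set
Γ∋ H b i = a H i ≡ b

IsSimpleH : {t k : ℕ} → OGraph t k → Set
IsSimpleH {t} {k} H =
  ((l : Fin k) → a H (tl l) ≢ a H (hd l)) ×
  ((l l' : Fin k) → l ≢ l' →
     ¬ ((a H (tl l) ≡ a H (tl l') × a H (hd l) ≡ a H (hd l')) ⊎
        (a H (tl l) ≡ a H (hd l') × a H (hd l) ≡ a H (tl l'))))

data Reach {t k : ℕ} (H : OGraph t k) : Fin t → Fin t → Set where
  here : ∀ {u} → Reach H u u
  fwd  : ∀ {u} (l : Fin k) → Reach H u (a H (tl l)) → Reach H u (a H (hd l))
  bwd  : ∀ {u} (l : Fin k) → Reach H u (a H (hd l)) → Reach H u (a H (tl l))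

IsConnectedH : {t k : ℕ} → OGraph t k → Set
IsConnectedH {t} H = (u v : Fin t) → Reach H u v

-- no leaves: no vertex has degree exactly 1, i.e. whenever b occurs at some
-- position i, it occurs at another position j ≠ i.
NoLeavesH : {t k : ℕ} → OGraph t k → Set
NoLeavesH {t} {k} H = (b : Fin t) (i : Fin (k * 2)) → a H i ≡ b →
  ∃[ j ] (j ≢ i × a H j ≡ b)

record SimpleGraph (n : ℕ) : Set₁ where
  field
    Adj     : Fin n → Fin n → Set
    sym     : ∀ {x y} → Adj x y → Adj y x
    irrefl  : ∀ {x} → ¬ Adj x x

-- H k-tuple of directed edges of the symmetric digraph of G, given by
-- endpoint labels v : positions → V(G)
IsEdgeTuple : {n k : ℕ} → SimpleGraph n → (Fin (k * 2) → Fin n) → Set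
IsEdgeTuple {n} {k} G v = (l : Fin k) → SimpleGraph.Adj G (v (tl l)) (v (hd l))

DistinctlyColorable : {t n k : ℕ} → OGraph t k →
  (v w : Fin (k * 2) → Fin n) → Set
DistinctlyColorable H v w = ∀ i j → a H i ≢ a H j → (v i ≢ v j × w i ≢ w j)

Condition1 : {t n k : ℕ} → OGraph t k →
  (v w : Fin (k * 2) → Fin n) → Fin t → Set
Condition1 H v w b = ∀ i j → Γ∋ H b i → Γ∋ H b j → (v i ≡ v j × w i ≡ w j)

Condition2 : {t n k : ℕ} → OGraph t k →
  (v w : Fin (k * 2) → Fin n) → Fin t → Set
Condition2 H v w b = ∀ i → Γ∋ H b i → v i ≡ w i

Condition3 : {t n k : ℕ} → OGraph t k →
  (v w : Fin (k * 2) → Fin n) → Fin t → Set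
Condition3 {n = n} H v w b = Σ (Fin n) λ x → Σ (Fin n) λ y →
  ∀ i → Γ∋ H b i → ((v i ≡ x × w i ≡ y) ⊎ (v i ≡ y × w i ≡ x))

-- Positions i ∈ Γ(b) and j ∉ Γ(b) sit at different vertices of H, so distinct
-- colorability gives v_i ≠ v_j and w_i ≠ w_j directly. For the cross pairs,
-- suppose v_i = w_j: then no w-value at b equals v_i. Under Condition 2 this
-- fails already at i itself. Under Condition 3 with pair {x, y}, say v_i = x,
-- no position at b can be coloured (y, x), so all are coloured (x, y) and
-- Condition 1 holds. The case w_i = v_j is the same with v and w exchanged.
module Submission where

open import Defs
open import Data.Nat using (ℕ; _*_)
open import Data.Fin using (Fin)
open import Data.Product using (_×_; _,_; proj₁; proj₂; swap)
open import Data.Sum using (_⊎_; inj₁; inj₂)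
import Data.Sum as Sum
open import Data.Empty using (⊥)
open import Function using (_∘_)
open import Relation.Nullary using (¬_; contradiction)
open import Relation.Binary.PropositionalEquality using (_≡_; _≢_; sym; trans)

∉Γ⇒≢ : ∀ {t k} (H : OGraph t k) {b i j} → Γ∋ H b i → ¬ Γ∋ H b j → a H i ≢ a H j
∉Γ⇒≢ H gi ngj ai≡aj = ngj (trans (sym ai≡aj) gi)

DistinctlyColorable-swap : ∀ {t n k} (H : OGraph t k) {v w : Fin (k * 2) → Fin n} →
  DistinctlyColorable H v w → DistinctlyColorable H w v
DistinctlyColorable-swap H dc i j ne = swap (dc i j ne)

module _ {t n k : ℕ} (H : OGraph t k) (b : Fin t) where

  ConstantAt : (v w : Fin (k * 2) → Fin n) → Fin n → Fin n → Set
  ConstantAt v w x y = ∀ i → Γ∋ H b i → v i ≡ x × w i ≡ y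

  ConstantAt⇒Condition1 : ∀ {v w x y} → ConstantAt v w x y → Condition1 H v w b
  ConstantAt⇒Condition1 const i j gi gj with const i gi | const j gj
  ... | vi≡x , wi≡y | vj≡x , wj≡y = trans vi≡x (sym vj≡x) , trans wi≡y (sym wj≡y)

  ConstantAt-if-w≢x : ∀ {v w x y} →
    (∀ i → Γ∋ H b i → (v i ≡ x × w i ≡ y) ⊎ (v i ≡ y × w i ≡ x)) →
    (∀ i → Γ∋ H b i → w i ≢ x) → ConstantAt v w x y
  ConstantAt-if-w≢x pairs w≢x i gi with pairs i gi
  ... | inj₁ xy = xy
  ... | inj₂ (_ , wi≡x) = contradiction wi≡x (w≢x i gi)

  Condition3⇒Condition1-if-w≢v : ∀ {v w i} → Condition3 H v w b → Γ∋ H b i →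
    (∀ i′ → Γ∋ H b i′ → w i′ ≢ v i) → Condition1 H v w b
  Condition3⇒Condition1-if-w≢v {i = i} (x , y , pairs) gi w≢vi
    with pairs i gi
  ... | inj₁ (vi≡x , _) = ConstantAt⇒Condition1
          (ConstantAt-if-w≢x pairs (λ i′ gi′ → w≢vi i′ gi′ ∘ λ e → trans e (sym vi≡x)))
  ... | inj₂ (vi≡y , _) = ConstantAt⇒Condition1
          (ConstantAt-if-w≢x (λ i′ gi′ → Sum.swap (pairs i′ gi′))
                             (λ i′ gi′ → w≢vi i′ gi′ ∘ λ e → trans e (sym vi≡y)))

  module _ {v w : Fin (k * 2) → Fin n} where

    Condition1-swap : Condition1 H v w b → Condition1 H w v b
    Condition1-swap c1 i j gi gj = swap (c1 i j gi gj)

    Condition2⊎3-swap : Condition2 H v w b ⊎ Condition3 H v w b →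
                        Condition2 H w v b ⊎ Condition3 H w v b
    Condition2⊎3-swap (inj₁ c2) = inj₁ (λ i gi → sym (c2 i gi))
    Condition2⊎3-swap (inj₂ (x , y , pairs)) =
      inj₂ (x , y , λ i gi → Sum.map swap swap (Sum.swap (pairs i gi)))

    v∈Γ≢w∉Γ : DistinctlyColorable H v w →
      Condition2 H v w b ⊎ Condition3 H v w b → ¬ Condition1 H v w b →
      ∀ {i j} → Γ∋ H b i → ¬ Γ∋ H b j → v i ≢ w j
    v∈Γ≢w∉Γ dc c2⊎c3 ¬c1 {i} {j} gi ngj vi≡wj = avoid c2⊎c3
      where
      w≢vi : ∀ i′ → Γ∋ H b i′ → w i′ ≢ v i
      w≢vi i′ gi′ wi′≡vi = proj₂ (dc i′ j (∉Γ⇒≢ H gi′ ngj)) (trans wi′≡vi vi≡wj)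

      avoid : Condition2 H v w b ⊎ Condition3 H v w b → ⊥
      avoid (inj₁ c2) = w≢vi i gi (sym (c2 i gi))
      avoid (inj₂ c3) = ¬c1 (Condition3⇒Condition1-if-w≢v c3 gi w≢vi)

lemma3p4 : (t k n : ℕ) (H : OGraph t k) →
    IsSimpleH H → IsConnectedH H → NoLeavesH H →
    (G : SimpleGraph n) (v w : Fin (k * 2) → Fin n) →
    IsEdgeTuple {k = k} G v → IsEdgeTuple {k = k} G w →
    (b : Fin t) (i j : Fin (k * 2)) → Γ∋ H b i → ¬ Γ∋ H b j →
    DistinctlyColorable H v w →
    (Condition2 H v w b ⊎ Condition3 H v w b) →
    ¬ Condition1 H v w b →
    (v i ≢ v j × v i ≢ w j) × (w i ≢ v j × w i ≢ w j)
lemma3p4 t k n H _ _ _ G v w _ _ b i j gi ngj dc c2⊎c3 ¬c1 =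
  (proj₁ (dc i j ai≢aj) , v∈Γ≢w∉Γ H b dc c2⊎c3 ¬c1 gi ngj) ,
  (v∈Γ≢w∉Γ H b (DistinctlyColorable-swap H dc) (Condition2⊎3-swap H b c2⊎c3)
           (¬c1 ∘ Condition1-swap H b) gi ngj ,
   proj₂ (dc i j ai≢aj))
  where
  ai≢aj : a H i ≢ a H j
  ai≢aj = ∉Γ⇒≢ H gi ngj
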